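{- For integers $n\ge 2$ and $m\ge 3$, $\operatorname{Z}(K_n*C_m)=(n-1)m + 2$.
   Context: All graphs are finite, simple and undirected. $K_n$ is the complete graph on $n$ vertices and $C_m$ the cycle on $m$ vertices. The lexicographic product $G*H$ has vertex set $V(G)\times V(H)$, with $(g,h)$ adjacent to $(g',h')$ iff either $g\sim g'$ in $G$, or $g=g'$ and $h\sim h'$ in $H$. Zero forcing: vertices are colored blue or white; if a blue vertex $u$ has exactly one white neighbor $w$, then $w$ is changed to blue. A zero forcing set is a set $B$ of vertices such that, coloring $B$ blue and all others white, repeated application of this rule colors all vertices blue; $\operatorname{Z}$ denotes the minimum cardinality of a zero forcing set. -}

module Defs where

open import Data.Nat using (ℕ; suc; _≤_)
open import Data.Fin using (Fin; toℕ; remQuot)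
open import Data.Fin.Subset using (Subset; _∈_; ∣_∣)
open import Data.Product using (_×_; proj₁; proj₂; ∃)
open import Data.Sum using (_⊎_)
open import Relation.Binary.PropositionalEquality using (_≡_; _≢_)
open import Relation.Nullary using (¬_)

Graph : ℕ → Set₁
Graph N = Fin N → Fin N → Set

K : (n : ℕ) → Graph n
K n i j = i ≢ j

-- Cycle C_m on Fin m: i ~ j iff j = i+1 (mod m) or i = j+1 (mod m).
CycSucc : (m : ℕ) → Fin m → Fin m → Set
CycSucc m i j = (suc (toℕ i) ≡ toℕ j) ⊎ ((suc (toℕ i) ≡ m) × (toℕ j ≡ 0))

C : (m : ℕ) → Graph m
C m i j = CycSucc m i j ⊎ CycSucc m j i

lex : {a b : ℕ} → Graph a → Graph b → Graph (a Data.Nat.* b)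
lex {a} {b} G H u v =
  G (proj₁ (pr u)) (proj₁ (pr v))
  ⊎ ((proj₁ (pr u) ≡ proj₁ (pr v)) × H (proj₂ (pr u)) (proj₂ (pr v)))
  where
  pr : Fin (a Data.Nat.* b) → Fin a × Fin b
  pr = remQuot {a} b

data Blue {N : ℕ} (G : Graph N) (B : Subset N) : Fin N → Set where
  initial : ∀ {v} → v ∈ B → Blue G B v
  force   : ∀ {u w} → Blue G B u → G u w
          → (∀ w' → G u w' → w' ≢ w → Blue G B w')
          → Blue G B w

ZeroForcingSet : {N : ℕ} → Graph N → Subset N → Set
ZeroForcingSet G B = ∀ v → Blue G B v

IsZeroForcingNumber : {N : ℕ} → Graph N → ℕ → Set
IsZeroForcingNumber {N} G k =
  (∃ λ (B : Subset N) → ZeroForcingSet G B × ∣ B ∣ ≡ k)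
  × (∀ (B : Subset N) → ZeroForcingSet G B → k ≤ ∣ B ∣)

-- A vertex can force only when it and all but one of its neighbours are blue, so in a graph of
-- minimum degree δ no set of fewer than δ vertices forces anything, and such a set, missing some
-- vertex, is not zero forcing. Every vertex of K_n * C_m has degree (n-1)m + 2. Conversely, all
-- vertices outside the copy of C_m over 0, together with (0,0) and (0,1), form a zero forcing set
-- of that size: (0,k+1) has every neighbour blue except (0,k+2), so C_m is forced around the cycle.
module Submission where

open import Data.Fin as Fin
  using (Fin; zero; suc; toℕ; fromℕ; fromℕ<; inject₁; punchIn; combine; remQuot; splitAt)
open import Data.Fin.Properties
  using ( any?; suc-injective; toℕ-injective; toℕ<n; toℕ-fromℕ; toℕ-fromℕ<; fromℕ<-toℕ
        ; toℕ-inject₁; punchIn-injective; punchInᵢ≢i; remQuot-combine; combine-remQuot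
        ; combine-injectiveʳ; join-splitAt; injective⇒≤ )
open import Data.Fin.Subset using (Subset; Side; inside; outside; _∈_; _∉_; ∣_∣; ∁; _-_)
open import Data.Fin.Subset.Properties
  using (x∈p∧x≢y⇒x∈p-y; x∈p⇒∣p-x∣<∣p∣; x∉p⇒x∈∁p; ∣∁p∣≡n∸∣p∣; ∣p∣≤n)
open import Data.Nat using (ℕ; zero; suc; _+_; _*_; _∸_; _≤_; _<_; _≤?_; _<?_; z≤n; s≤s; s≤s⁻¹)
import Data.Nat.Properties as ℕ
open import Data.Product using (_×_; _,_; proj₁; proj₂; ∃; uncurry; map₁)
open import Data.Sum using (_⊎_; inj₁; inj₂)
open import Data.Vec using (tabulate; lookup)
open import Data.Vec.Functional using (_∷_)
open import Data.Vec.Properties using (lookup∘tabulate; lookup⇒[]=; []=⇒lookup)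
open import Function using (_∘_; id)
open import Function.Definitions using (Injective)
open import Relation.Binary.Definitions using (Irreflexive)
open import Relation.Binary.PropositionalEquality
open import Relation.Nullary using (¬_; yes; no; contradiction)

open import Defs

injective⇒≤∣p∣ : ∀ {k N} (p : Subset N) (f : Fin k → Fin N) →
                 Injective _≡_ _≡_ f → (∀ i → f i ∈ p) → k ≤ ∣ p ∣
injective⇒≤∣p∣ {zero}  p f f-inj f∈p = z≤n
injective⇒≤∣p∣ {suc k} p f f-inj f∈p =
  ℕ.≤-trans (s≤s k≤∣p-f₀∣) (x∈p⇒∣p-x∣<∣p∣ (f∈p zero))
  where
  k≤∣p-f₀∣ : k ≤ ∣ p - f zero ∣
  k≤∣p-f₀∣ = injective⇒≤∣p∣ (p - f zero) (f ∘ suc) (suc-injective ∘ f-inj)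
               (λ i → x∈p∧x≢y⇒x∈p-y (f∈p (suc i)) ((λ ()) ∘ f-inj))

injective⇒≤1+∣p∣ : ∀ {k N} (p : Subset N) (w : Fin N) (f : Fin k → Fin N) →
                   Injective _≡_ _≡_ f → (∀ i → f i ≢ w → f i ∈ p) → k ≤ suc ∣ p ∣
injective⇒≤1+∣p∣ {zero}  p w f f-inj f∈p = z≤n
injective⇒≤1+∣p∣ {suc k} p w f f-inj f∈p with any? (λ i → f i Fin.≟ w)
... | yes (i , fᵢ≡w) = s≤s (injective⇒≤∣p∣ p (f ∘ punchIn i) (punchIn-injective i _ _ ∘ f-inj)
                          (λ j → f∈p (punchIn i j) (λ fⱼ≡w → punchInᵢ≢i i j (f-inj (trans fⱼ≡w (sym fᵢ≡w))))))
... | no  f≢w       = ℕ.m≤n⇒m≤1+n (injective⇒≤∣p∣ p f f-inj (λ i → f∈p i (f≢w ∘ (i ,_))))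

∀-combine : ∀ {a b} {P : Fin (a * b) → Set} → (∀ g h → P (combine g h)) → ∀ v → P v
∀-combine {a} {b} {P} P-combine v =
  subst P (combine-remQuot {a} b v) (P-combine (proj₁ (remQuot {a} b v)) (proj₂ (remQuot {a} b v)))

MinDegree : ∀ {N} → Graph N → ℕ → Set
MinDegree {N} G δ = ∀ u → ∃ λ (f : Fin δ → Fin N) → Injective _≡_ _≡_ f × (∀ i → G u (f i))

closedNeighbourhood-injective : ∀ {N δ} {G : Graph N} → Irreflexive _≡_ G →
  ∀ {u} {f : Fin δ → Fin N} → Injective _≡_ _≡_ f → (∀ i → G u (f i)) → Injective _≡_ _≡_ (u ∷ f)
closedNeighbourhood-injective irr f-inj u~f {zero}  {zero}  _     = refl
closedNeighbourhood-injective irr f-inj u~f {zero}  {suc j} u≡fⱼ  = contradiction (u~f j) (irr u≡fⱼ)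
closedNeighbourhood-injective irr f-inj u~f {suc i} {zero}  fᵢ≡u  = contradiction (u~f i) (irr (sym fᵢ≡u))
closedNeighbourhood-injective irr f-inj u~f {suc i} {suc j} fᵢ≡fⱼ = cong suc (f-inj fᵢ≡fⱼ)

module _ {N δ} {G : Graph N} (deg : MinDegree G δ) (irr : Irreflexive _≡_ G) where

  blue⇒∈ : ∀ {B v} → ∣ B ∣ < δ → Blue G B v → v ∈ B
  blue⇒∈ ∣B∣<δ (initial v∈B) = v∈B
  blue⇒∈ {B} ∣B∣<δ (force {u} {w} u-blue _ others-blue) with deg u
  ... | f , f-inj , u~f = contradiction δ≤∣B∣ (ℕ.<⇒≱ ∣B∣<δ)
    where
    closed∈B : ∀ i → (u ∷ f) i ≢ w → (u ∷ f) i ∈ B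
    closed∈B zero    _    = blue⇒∈ ∣B∣<δ u-blue
    closed∈B (suc i) fᵢ≢w = blue⇒∈ ∣B∣<δ (others-blue (f i) (u~f i) fᵢ≢w)

    δ≤∣B∣ : δ ≤ ∣ B ∣
    δ≤∣B∣ = s≤s⁻¹ (injective⇒≤1+∣p∣ B w (u ∷ f)
                       (closedNeighbourhood-injective irr f-inj u~f) closed∈B)

  minDegree≤∣zeroForcingSet∣ : ∀ {B} → Fin N → ZeroForcingSet G B → δ ≤ ∣ B ∣
  minDegree≤∣zeroForcingSet∣ {B} v zfs with δ ≤? ∣ B ∣ | deg v
  ... | yes δ≤∣B∣ | _ = δ≤∣B∣
  ... | no  δ≰∣B∣ | f , f-inj , v~f = contradiction (ℕ.≤-trans 1+δ≤N N≤∣B∣) (ℕ.<-asym ∣B∣<δ)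
    where
    ∣B∣<δ : ∣ B ∣ < δ
    ∣B∣<δ = ℕ.≰⇒> δ≰∣B∣

    N≤∣B∣ : N ≤ ∣ B ∣
    N≤∣B∣ = injective⇒≤∣p∣ B id id (λ u → blue⇒∈ ∣B∣<δ (zfs u))

    1+δ≤N : suc δ ≤ N
    1+δ≤N = injective⇒≤ (closedNeighbourhood-injective irr f-inj v~f)

module Lex {a b} {G : Graph a} {H : Graph b} where

  LexAdjacent : Fin a × Fin b → Fin a × Fin b → Set
  LexAdjacent p q = G (proj₁ p) (proj₁ q) ⊎ (proj₁ p ≡ proj₁ q × H (proj₂ p) (proj₂ q))

  lex-combine⁺ : ∀ {p q} → LexAdjacent p q → lex G H (uncurry combine p) (uncurry combine q)
  lex-combine⁺ {g , h} {g′ , h′} =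
    subst₂ LexAdjacent (sym (remQuot-combine g h)) (sym (remQuot-combine g′ h′))

  lex-combine⁻ : ∀ {p q} → lex G H (uncurry combine p) (uncurry combine q) → LexAdjacent p q
  lex-combine⁻ {g , h} {g′ , h′} = subst₂ LexAdjacent (remQuot-combine g h) (remQuot-combine g′ h′)

  lex-irreflexive : Irreflexive _≡_ G → Irreflexive _≡_ H → Irreflexive _≡_ (lex G H)
  lex-irreflexive irrG irrH refl (inj₁ g~g)       = irrG refl g~g
  lex-irreflexive irrG irrH refl (inj₂ (_ , h~h)) = irrH refl h~h

  lex-minDegree : ∀ {d e} → Irreflexive _≡_ G → MinDegree G d → MinDegree H e →
                  MinDegree (lex G H) (d * b + e)
  lex-minDegree {d} {e} irrG degG degH = ∀-combine neighbours
    where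
    neighbours : ∀ g h → ∃ λ (f : Fin (d * b + e) → Fin (a * b)) →
                 Injective _≡_ _≡_ f × (∀ i → lex G H (combine g h) (f i))
    neighbours g h with degG g | degH h
    ... | fG , fG-inj , g~fG | fH , fH-inj , h~fH =
      uncurry combine ∘ pick ∘ splitAt (d * b) ,
      splitAt-injective ∘ pick-injective ∘ combine-inj ,
      (λ i → lex-combine⁺ (pick-adjacent (splitAt (d * b) i)))
      where
      pick : Fin (d * b) ⊎ Fin e → Fin a × Fin b
      pick (inj₁ i) = map₁ fG (remQuot {d} b i)
      pick (inj₂ j) = g , fH j

      remQuot-injective : Injective _≡_ _≡_ (remQuot {d} b)
      remQuot-injective {i} {j} eq =
        trans (sym (combine-remQuot {d} b i))
              (trans (cong (uncurry combine) eq) (combine-remQuot {d} b j))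

      pick-injective : Injective _≡_ _≡_ pick
      pick-injective {inj₁ i} {inj₁ j} eq =
        cong inj₁ (remQuot-injective (cong₂ _,_ (fG-inj (cong proj₁ eq)) (cong proj₂ eq)))
      pick-injective {inj₁ i} {inj₂ j} eq = contradiction (g~fG _) (irrG (sym (cong proj₁ eq)))
      pick-injective {inj₂ i} {inj₁ j} eq = contradiction (g~fG _) (irrG (cong proj₁ eq))
      pick-injective {inj₂ i} {inj₂ j} eq = cong inj₂ (fH-inj (cong proj₂ eq))

      pick-adjacent : ∀ s → LexAdjacent (g , h) (pick s)
      pick-adjacent (inj₁ i) = inj₁ (g~fG _)
      pick-adjacent (inj₂ j) = inj₂ (refl , h~fH j)

      splitAt-injective : Injective _≡_ _≡_ (splitAt (d * b) {e})
      splitAt-injective {i} {j} eq =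
        trans (sym (join-splitAt (d * b) e i))
              (trans (cong (Fin.join (d * b) e) eq) (join-splitAt (d * b) e j))

      combine-inj : Injective _≡_ _≡_ (uncurry (combine {a} {b}))
      combine-inj {p} {q} eq =
        trans (sym (remQuot-combine (proj₁ p) (proj₂ p)))
              (trans (cong (remQuot b) eq) (remQuot-combine (proj₁ q) (proj₂ q)))

K-irreflexive : ∀ n → Irreflexive _≡_ (K n)
K-irreflexive n i≡j i≢j = i≢j i≡j

K-minDegree : ∀ n → MinDegree (K n) (n ∸ 1)
K-minDegree (suc n) i = punchIn i , punchIn-injective i _ _ , (λ j → punchInᵢ≢i i j ∘ sym)

-- CycSucc m i j unfolds to CycSuccℕ m (toℕ i) (toℕ j); on ℕ the facts below follow by matching on refl.
CycSuccℕ : ℕ → ℕ → ℕ → Set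
CycSuccℕ m x y = (suc x ≡ y) ⊎ ((suc x ≡ m) × (y ≡ 0))

CycSuccℕ-irreflexive : ∀ {m x} → 2 ≤ m → ¬ CycSuccℕ m x x
CycSuccℕ-irreflexive _             (inj₁ 1+x≡x)       = ℕ.1+n≢n 1+x≡x
CycSuccℕ-irreflexive (s≤s (s≤s _)) (inj₂ (() , refl))

CycSuccℕ-asym : ∀ {m x y} → 3 ≤ m → CycSuccℕ m x y → ¬ CycSuccℕ m y x
CycSuccℕ-asym _                   (inj₁ refl)        (inj₁ 2+x≡x)       = ℕ.m≢1+n+m _ (sym 2+x≡x)
CycSuccℕ-asym (s≤s (s≤s (s≤s _))) (inj₁ refl)        (inj₂ (() , refl))
CycSuccℕ-asym (s≤s (s≤s (s≤s _))) (inj₂ (() , refl)) (inj₁ refl)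
CycSuccℕ-asym (s≤s (s≤s (s≤s _))) (inj₂ (() , refl)) (inj₂ (_ , refl))

next : ∀ {m} (i : Fin (suc m)) → ∃ λ j → CycSucc (suc m) i j
next {m} i with suc (toℕ i) <? suc m
... | yes 1+i<m = fromℕ< 1+i<m , inj₁ (sym (toℕ-fromℕ< 1+i<m))
... | no  1+i≮m = zero , inj₂ (ℕ.≤-antisym (toℕ<n i) (ℕ.≮⇒≥ 1+i≮m) , refl)

prev : ∀ {m} (j : Fin (suc m)) → ∃ λ i → CycSucc (suc m) i j
prev {m} zero = fromℕ m , inj₂ (cong suc (toℕ-fromℕ m) , refl)
prev (suc j)  = inject₁ j , inj₁ (cong suc (toℕ-inject₁ j))

C-irreflexive : ∀ {m} → 2 ≤ m → Irreflexive _≡_ (C m)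
C-irreflexive 2≤m refl (inj₁ i→i) = CycSuccℕ-irreflexive 2≤m i→i
C-irreflexive 2≤m refl (inj₂ i→i) = CycSuccℕ-irreflexive 2≤m i→i

C-minDegree : ∀ {m} → 3 ≤ m → MinDegree (C m) 2
C-minDegree {suc m} 3≤m i = neighbour , neighbour-injective , adjacent
  where
  neighbour : Fin 2 → Fin (suc m)
  neighbour zero       = proj₁ (next i)
  neighbour (suc zero) = proj₁ (prev i)

  next≢prev : proj₁ (next i) ≢ proj₁ (prev i)
  next≢prev eq = CycSuccℕ-asym 3≤m (proj₂ (next i))
                   (subst (λ j → CycSucc (suc m) j i) (sym eq) (proj₂ (prev i)))

  neighbour-injective : Injective _≡_ _≡_ neighbour
  neighbour-injective {zero}     {zero}     _  = refl
  neighbour-injective {zero}     {suc zero} eq = contradiction eq next≢prev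
  neighbour-injective {suc zero} {zero}     eq = contradiction (sym eq) next≢prev
  neighbour-injective {suc zero} {suc zero} _  = refl

  adjacent : ∀ k → C (suc m) i (neighbour k)
  adjacent zero       = inj₁ (proj₂ (next i))
  adjacent (suc zero) = inj₂ (proj₂ (prev i))

module Seed (a r : ℕ) where

  seedSide : Fin (suc a) → Fin (2 + r) → Side
  seedSide zero (suc (suc _)) = outside
  seedSide _    _             = inside

  vertex : Fin (suc a) → Fin (2 + r) → Fin (suc a * (2 + r))
  vertex = combine

  seedSideAt : Fin (suc a * (2 + r)) → Side
  seedSideAt = uncurry seedSide ∘ remQuot {suc a} (2 + r)

  seed : Subset (suc a * (2 + r))
  seed = tabulate seedSideAt

  lookup-seed : ∀ (g : Fin (suc a)) (c : Fin (2 + r)) → lookup seed (vertex g c) ≡ seedSide g c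
  lookup-seed g c =
    trans (lookup∘tabulate seedSideAt (vertex g c)) (cong (uncurry seedSide) (remQuot-combine g c))

  ∈seed : ∀ (g : Fin (suc a)) (c : Fin (2 + r)) → seedSide g c ≡ inside → vertex g c ∈ seed
  ∈seed g c side≡inside = lookup⇒[]= (vertex g c) seed (trans (lookup-seed g c) side≡inside)

  row₀-tail∉seed : ∀ (c : Fin r) → vertex zero (suc (suc c)) ∉ seed
  row₀-tail∉seed c c∈seed with trans (sym (lookup-seed zero (suc (suc c)))) ([]=⇒lookup c∈seed)
  ... | ()

  ∣seed∣≤ : ∣ seed ∣ ≤ a * (2 + r) + 2
  ∣seed∣≤ = begin
    ∣ seed ∣                        ≡⟨ ℕ.m∸[m∸n]≡n (∣p∣≤n seed) ⟨
    N ∸ (N ∸ ∣ seed ∣)              ≡⟨ cong (N ∸_) (∣∁p∣≡n∸∣p∣ seed) ⟨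
    N ∸ ∣ ∁ seed ∣                  ≤⟨ ℕ.∸-monoʳ-≤ N r≤∣∁seed∣ ⟩
    (2 + r) + a * (2 + r) ∸ r       ≡⟨ ℕ.+-∸-comm (a * (2 + r)) (ℕ.m≤n+m r 2) ⟩
    (2 + r ∸ r) + a * (2 + r)       ≡⟨ cong (_+ a * (2 + r)) (ℕ.m+n∸n≡m 2 r) ⟩
    2 + a * (2 + r)                 ≡⟨ ℕ.+-comm 2 _ ⟩
    a * (2 + r) + 2                 ∎
    where
    open ℕ.≤-Reasoning
    N = suc a * (2 + r)

    row₀-tail : Fin r → Fin N
    row₀-tail c = vertex zero (suc (suc c))

    r≤∣∁seed∣ : r ≤ ∣ ∁ seed ∣
    r≤∣∁seed∣ = injective⇒≤∣p∣ (∁ seed) row₀-tail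
      (suc-injective ∘ suc-injective ∘ combine-injectiveʳ {suc a} zero _ zero _)
      (x∉p⇒x∈∁p ∘ row₀-tail∉seed)

  module _ {G : Graph (suc a)} (irr : Irreflexive _≡_ G) where

    private
      Γ : Graph (suc a * (2 + r))
      Γ = lex G (C (2 + r))

    open Lex {G = G} {H = C (2 + r)} using (LexAdjacent; lex-combine⁺; lex-combine⁻)

    row₀-blue : ∀ k (k<ℓ : k < 2 + r) → Blue Γ seed (vertex zero (fromℕ< k<ℓ))
    row₀-blue 0 _ = initial (∈seed zero zero refl)
    row₀-blue 1 _ = initial (∈seed zero (suc zero) refl)
    row₀-blue (suc (suc k)) k+2<ℓ = force (row₀-blue (suc k) k+1<ℓ) forward (∀-combine others)
      where
      k+1<ℓ : suc k < 2 + r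
      k+1<ℓ = ℕ.<⇒≤ k+2<ℓ

      k<ℓ : k < 2 + r
      k<ℓ = ℕ.<⇒≤ k+1<ℓ

      d c : Fin (2 + r)
      d = fromℕ< k+1<ℓ
      c = fromℕ< k+2<ℓ

      toℕ-d : toℕ d ≡ suc k
      toℕ-d = toℕ-fromℕ< k+1<ℓ

      forward : Γ (vertex zero d) (vertex zero c)
      forward = lex-combine⁺ {p = zero , d} {q = zero , c}
        (inj₂ (refl , inj₁ (inj₁ (trans (cong suc toℕ-d) (sym (toℕ-fromℕ< k+2<ℓ))))))

      neighbour : ∀ g h → LexAdjacent (zero , d) (g , h) → vertex g h ≢ vertex zero c →
                  Blue Γ seed (vertex g h)
      neighbour (suc g) h _ _ = initial (∈seed (suc g) h refl)
      neighbour zero h (inj₁ 0~0) _ = contradiction 0~0 (irr refl)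
      neighbour zero h (inj₂ (_ , inj₁ (inj₁ 1+d≡h))) h≢c =
        contradiction (cong (vertex zero) (toℕ-injective h≡c)) h≢c
        where
        h≡c : toℕ h ≡ toℕ c
        h≡c = trans (sym 1+d≡h) (trans (cong suc toℕ-d) (sym (toℕ-fromℕ< k+2<ℓ)))
      neighbour zero zero    (inj₂ (_ , inj₁ (inj₂ _)))        _ = initial (∈seed zero zero refl)
      neighbour zero (suc h) (inj₂ (_ , inj₁ (inj₂ (_ , ())))) _
      neighbour zero h (inj₂ (_ , inj₂ (inj₁ 1+h≡d))) _ =
        subst (Blue Γ seed ∘ vertex zero) (sym (toℕ-injective h≡fromℕ<k)) (row₀-blue k k<ℓ)
        where
        h≡fromℕ<k : toℕ h ≡ toℕ (fromℕ< k<ℓ)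
        h≡fromℕ<k = trans (ℕ.suc-injective (trans 1+h≡d toℕ-d)) (sym (toℕ-fromℕ< k<ℓ))
      neighbour zero h (inj₂ (_ , inj₂ (inj₂ (_ , d≡0)))) _ = contradiction (trans (sym toℕ-d) d≡0) λ ()

      others : ∀ g h → Γ (vertex zero d) (vertex g h) → vertex g h ≢ vertex zero c →
               Blue Γ seed (vertex g h)
      others g h d~gh = neighbour g h (lex-combine⁻ {p = zero , d} {q = g , h} d~gh)

    seed-zeroForcingSet : ZeroForcingSet Γ seed
    seed-zeroForcingSet = ∀-combine blue
      where
      blue : ∀ g h → Blue Γ seed (vertex g h)
      blue (suc g) h = initial (∈seed (suc g) h refl)
      blue zero    h =
        subst (Blue Γ seed ∘ vertex zero) (fromℕ<-toℕ h (toℕ<n h)) (row₀-blue (toℕ h) (toℕ<n h))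

corollary3p10 : (n m : ℕ) → 2 ≤ n → 3 ≤ m →
    IsZeroForcingNumber (lex (K n) (C m)) ((n ∸ 1) * m + 2)
corollary3p10 zero    _                 ()  _
corollary3p10 (suc n) zero              _   ()
corollary3p10 (suc n) (suc zero)        _   (s≤s ())
corollary3p10 (suc n) m@(suc (suc r)) _   3≤m =
  (seed , seed-zeroForcingSet K-irr , ℕ.≤-antisym ∣seed∣≤ (minDegree≤∣B∣ (seed-zeroForcingSet K-irr)))
  , λ _ → minDegree≤∣B∣
  where
  open Seed n r
  open Lex {G = K (suc n)} {H = C m} using (lex-irreflexive; lex-minDegree)

  K-irr : Irreflexive _≡_ (K (suc n))
  K-irr = K-irreflexive (suc n)

  minDegree≤∣B∣ : ∀ {B} → ZeroForcingSet (lex (K (suc n)) (C m)) B → n * m + 2 ≤ ∣ B ∣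
  minDegree≤∣B∣ = minDegree≤∣zeroForcingSet∣
    (lex-minDegree K-irr (K-minDegree (suc n)) (C-minDegree 3≤m))
    (lex-irreflexive K-irr (C-irreflexive (ℕ.<⇒≤ 3≤m)))
    (vertex zero zero)
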